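{- For each quantifier-free insertion query $\rho(\bar p)$ for the edge relation $E$ there is a constant $m\in\mathbb N$ such that for each directed acyclic graph $G$ and each change $\delta=\rho(\bar a)$, either $\delta(G)$ has a cycle with at most $m$ bridges, or for all nodes $u$ and $v$ of $G$ such that there is a path from $u$ to $v$ in $\delta(G)$ it holds that $\mathrm{bd}(u,v)\le m$.
   Context: Graphs are structures with one binary relation $E$ (directed edges). A quantifier-free insertion query $\rho(\bar p)$ for $E$ is given by a formula $\mu(\bar p;x,y)=E(x,y)\lor\varphi(\bar p,x,y)$ with $\varphi$ quantifier-free over $\{E\}$; for a tuple $\bar a$ of nodes, $\delta=\rho(\bar a)$ maps $G$ to the graph $\delta(G)$ on the same nodes with edge set $\{(b,c)\mid G\models\mu(\bar a;b,c)\}$. A bridge is an edge of $\delta(G)$ that is not an edge of $G$. For nodes $u,v$ with a path from $u$ to $v$ in $\delta(G)$, the bridge distance $\mathrm{bd}(u,v)$ is the minimal number $d$ such that there is a path from $u$ to $v$ in $\delta(G)$ using $d$ bridges. -}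

module Defs where

open import Data.Nat using (ℕ; zero; suc; _≤_)
open import Data.Fin using (Fin; _≟_)
open import Data.Bool using (Bool; true; false; not; _∧_; _∨_)
open import Data.Product using (Σ; _×_; ∃-syntax)
open import Relation.Binary.PropositionalEquality using (_≡_)
open import Relation.Nullary.Decidable using (⌊_⌋)

Graph : ℕ → Set
Graph n = Fin n → Fin n → Bool

data QF (V : Set) : Set where
  tt ff : QF V
  edge  : V → V → QF V
  equal : V → V → QF V
  neg   : QF V → QF V
  conj  : QF V → QF V → QF V
  disj  : QF V → QF V → QF V

⟦_⟧ : ∀ {V n} → QF V → Graph n → (V → Fin n) → Bool
⟦ tt ⟧        E σ = true
⟦ ff ⟧        E σ = false
⟦ edge s t ⟧  E σ = E (σ s) (σ t)
⟦ equal s t ⟧ E σ = ⌊ σ s ≟ σ t ⌋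
⟦ neg φ ⟧     E σ = not (⟦ φ ⟧ E σ)
⟦ conj φ ψ ⟧  E σ = ⟦ φ ⟧ E σ ∧ ⟦ ψ ⟧ E σ
⟦ disj φ ψ ⟧  E σ = ⟦ φ ⟧ E σ ∨ ⟦ ψ ⟧ E σ

data Var (k : ℕ) : Set where
  par : Fin k → Var k
  x y : Var k

-- A quantifier-free insertion query ρ(p̄) for E with k parameters is given by
-- the QF formula φ(p̄,x,y); its update formula is μ(p̄;x,y) = E(x,y) ∨ φ(p̄,x,y).
record InsertionQuery : Set where
  field
    arity : ℕ
    φ     : QF (Var arity)
open InsertionQuery public

assign : ∀ {k n} → (Fin k → Fin n) → Fin n → Fin n → Var k → Fin n
assign a b c (par i) = a i
assign a b c x = b
assign a b c y = c

apply : ∀ {n} (ρ : InsertionQuery) → (Fin (arity ρ) → Fin n) → Graph n → Graph n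
apply ρ a E b c = E b c ∨ ⟦ φ ρ ⟧ E (assign a b c)

-- Walks in the updated graph H = δ(G), indexed by their length and by the
-- number of bridges (edges of H that are not edges of G) they use.
data Walk {n} (E H : Graph n) : Fin n → Fin n → ℕ → ℕ → Set where
  []     : ∀ {u} → Walk E H u u 0 0
  old    : ∀ {u w v l d} → E u w ≡ true →
           Walk E H w v l d → Walk E H u v (suc l) d
  bridge : ∀ {u w v l d} → H u w ≡ true → E u w ≡ false →
           Walk E H w v l d → Walk E H u v (suc l) (suc d)

data Path {n} (E : Graph n) : Fin n → Fin n → ℕ → Set where
  []  : ∀ {u} → Path E u u 0
  _∷_ : ∀ {u w v l} → E u w ≡ true → Path E w v l → Path E u v (suc l)

Acyclic : ∀ {n} → Graph n → Set
Acyclic {n} E = ∀ (u : Fin n) (l : ℕ) → Path E u u (suc l) → Data.Empty.⊥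
  where import Data.Empty

HasCycleWithin : ∀ {n} → ℕ → Graph n → Graph n → Set
HasCycleWithin {n} m E H =
  Σ (Fin n) λ u → Σ ℕ λ l → Σ ℕ λ d → d ≤ m × Walk E H u u (suc l) d

Reachable : ∀ {n} → Graph n → Graph n → Fin n → Fin n → Set
Reachable E H u v = Σ ℕ λ l → Σ ℕ λ d → Walk E H u v l d

-- bd(u,v) ≤ m: some path from u to v in H uses at most m bridges
-- (equivalent to the minimum number of bridges being ≤ m).
BdWithin : ∀ {n} → ℕ → Graph n → Graph n → Fin n → Fin n → Set
BdWithin m E H u v = Σ ℕ λ l → Σ ℕ λ d → d ≤ m × Walk E H u v l d

module Submission where

-- The type of a node c is the table of edges and
-- equalities among the tuple c·ā; there are typeCount = N such types, and
-- whether b → c is a bridge depends only on the type of c once b has no edge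
-- or equality with c.  Take m = N + 2.  If a walk in δ(G) has more than m
-- bridges, two of its first N + 1 bridges b → c and b' → c' have targets of
-- the same type (pigeonhole).  Then either b = c or G(c,b) (a cycle with one
-- bridge), or G(c',b) (a cycle with at most N + 2 bridges), or b = c' or
-- G(b,c') or b → c' is a bridge; in the last three cases the walk is
-- shortcut to one with fewer bridges.  Well-founded induction on the number of
-- bridges gives a cycle or a walk with at most m bridges.  Cycles with at most
-- m bridges are decidable (one exists iff one of length ≤ n does), which turns
-- this per-walk dichotomy into the uniform one.

open import Defs
open import Data.Nat using (ℕ; zero; suc; _+_; _*_; _^_; _≤_; _<_; z≤n; s≤s; s≤s⁻¹; _≤?_)
open import Data.Nat.Properties
  using (+-suc; +-comm; ≤-reflexive; n≤1+n; n<1+n; m≤n+m; m≤n⇒m≤1+n; ≰⇒>; ≤-trans; ≤-refl; +-monoʳ-<)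
open import Data.Nat.Induction using (<-wellFounded)
open import Induction.WellFounded using (Acc; acc)
open import Data.Fin using (Fin; zero; suc; toℕ; inject≤; fromℕ<; funToFin; finToFun; combine; _≟_)
open import Data.Fin.Properties
  using (pigeonhole; toℕ-inject≤; toℕ<n; toℕ-fromℕ<; any?; finToFun-funToFin; combine-injective)
open import Data.Vec.Functional using () renaming (_∷_ to _∷ᵛ_)
open import Data.Bool using (Bool; true; false; not; _∧_; _∨_)
import Data.Bool as Bool
open import Data.Product using (Σ; _×_; _,_; ∃)
open import Data.Sum using (_⊎_; inj₁; inj₂)
open import Data.Empty using (⊥-elim)
open import Relation.Nullary using (Dec; yes; no)
open import Relation.Nullary.Decidable using (⌊_⌋; map′; _×-dec_; _⊎-dec_)
open import Relation.Binary.PropositionalEquality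
  using (_≡_; _≢_; refl; sym; trans; cong; cong₂; subst; subst₂)
open import Function using (_∘_)

pigeonhole-early : ∀ {d t} → t < d → (f : Fin d → Fin t) →
  Σ (Fin d) λ i → Σ (Fin d) λ j → toℕ i < toℕ j × toℕ j ≤ t × f i ≡ f j
pigeonhole-early {t = t} t<d f with pigeonhole (n<1+n t) (f ∘ λ i → inject≤ i t<d)
... | i , j , i<j , same =
  inject≤ i t<d , inject≤ j t<d ,
  subst₂ _<_ (sym (toℕ-inject≤ i t<d)) (sym (toℕ-inject≤ j t<d)) i<j ,
  subst (_≤ t) (sym (toℕ-inject≤ j t<d)) (s≤s⁻¹ (toℕ<n j)) ,
  same

bit : Bool → Fin 2
bit false = zero
bit true  = suc zero

bit-injective : ∀ {p q} → bit p ≡ bit q → p ≡ q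
bit-injective {false} {false} _ = refl
bit-injective {true}  {true}  _ = refl

funToFin-injective : ∀ {m r} {f g : Fin m → Fin r} → funToFin f ≡ funToFin g → ∀ i → f i ≡ g i
funToFin-injective {f = f} {g} eq i =
  trans (sym (finToFun-funToFin f i)) (trans (cong (λ z → finToFun z i) eq) (finToFun-funToFin g i))

table : ∀ {n K} → (Fin n → Fin n → Bool) → (Fin K → Fin n) → Fin ((2 ^ K) ^ K)
table R t = funToFin λ i → funToFin λ j → bit (R (t i) (t j))

table-injective : ∀ {n K} (R : Fin n → Fin n → Bool) {t t' : Fin K → Fin n} →
  table R t ≡ table R t' → ∀ i j → R (t i) (t j) ≡ R (t' i) (t' j)
table-injective R eq i j = bit-injective (funToFin-injective (funToFin-injective eq i) j)

_≡ᵇ_ : ∀ {n} → Fin n → Fin n → Bool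
p ≡ᵇ q = ⌊ p ≟ q ⌋

≡ᵇ-false : ∀ {n} {p q : Fin n} → p ≢ q → (p ≡ᵇ q) ≡ false
≡ᵇ-false {p = p} {q} p≢q with p ≟ q
... | yes p≡q = ⊥-elim (p≢q p≡q)
... | no _    = refl

⟦⟧-atomic : ∀ {V n} (ψ : QF V) (G : Graph n) {σ σ' : V → Fin n} →
  (∀ s t → G (σ s) (σ t) ≡ G (σ' s) (σ' t)) →
  (∀ s t → (σ s ≡ᵇ σ t) ≡ (σ' s ≡ᵇ σ' t)) →
  ⟦ ψ ⟧ G σ ≡ ⟦ ψ ⟧ G σ'
⟦⟧-atomic tt          G edges eqs = refl
⟦⟧-atomic ff          G edges eqs = refl
⟦⟧-atomic (edge s t)  G edges eqs = edges s t
⟦⟧-atomic (equal s t) G edges eqs = eqs s t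
⟦⟧-atomic (neg ψ)     G edges eqs = cong not (⟦⟧-atomic ψ G edges eqs)
⟦⟧-atomic (conj ψ χ)  G edges eqs = cong₂ _∧_ (⟦⟧-atomic ψ G edges eqs) (⟦⟧-atomic χ G edges eqs)
⟦⟧-atomic (disj ψ χ)  G edges eqs = cong₂ _∨_ (⟦⟧-atomic ψ G edges eqs) (⟦⟧-atomic χ G edges eqs)

assign-respects : ∀ {n k} (R : Fin n → Fin n → Bool) {a : Fin k → Fin n} {b c c' : Fin n} →
  (∀ i j → R ((c ∷ᵛ a) i) ((c ∷ᵛ a) j) ≡ R ((c' ∷ᵛ a) i) ((c' ∷ᵛ a) j)) →
  R b c ≡ R b c' → R c b ≡ R c' b →
  ∀ s t → R (assign a b c s) (assign a b c t) ≡ R (assign a b c' s) (assign a b c' t)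
assign-respects R tuple bc cb (par i) (par j) = refl
assign-respects R tuple bc cb (par i) x       = refl
assign-respects R tuple bc cb (par i) y       = tuple (suc i) zero
assign-respects R tuple bc cb x       (par j) = refl
assign-respects R tuple bc cb x       x       = refl
assign-respects R tuple bc cb x       y       = bc
assign-respects R tuple bc cb y       (par j) = tuple zero (suc j)
assign-respects R tuple bc cb y       x       = cb
assign-respects R tuple bc cb y       y       = tuple zero zero

module Walks {n} (E H : Graph n) where

  W : Fin n → Fin n → ℕ → ℕ → Set
  W = Walk E H

  _++ʷ_ : ∀ {u w v l₁ l₂ d₁ d₂} → W u w l₁ d₁ → W w v l₂ d₂ → W u v (l₁ + l₂) (d₁ + d₂)
  []             ++ʷ q = q
  old e p        ++ʷ q = old e (p ++ʷ q)
  bridge h e p   ++ʷ q = bridge h e (p ++ʷ q)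
  infixr 5 _++ʷ_

  bridgeTarget : ∀ {u v l d} → W u v l d → Fin d → Fin n
  bridgeTarget (old e w)              j       = bridgeTarget w j
  bridgeTarget (bridge {w = c} h e w) zero    = c
  bridgeTarget (bridge h e w)         (suc j) = bridgeTarget w j

  record AtBridge (u v : Fin n) (d : ℕ) (j : Fin d) (c₀ : Fin n) : Set where
    constructor atBridge
    field
      b c      : Fin n
      l₁ l₂ d₂ : ℕ
      before   : W u b l₁ (toℕ j)
      new      : H b c ≡ true
      notOld   : E b c ≡ false
      after    : W c v l₂ d₂
      count    : d ≡ suc (toℕ j + d₂)
      target   : c₀ ≡ c

  splitAt : ∀ {u v l d} (w : W u v l d) (j : Fin d) → AtBridge u v d j (bridgeTarget w j)
  splitAt (old e w) j with splitAt w j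
  ... | atBridge b c l₁ l₂ d₂ P h e' Q cnt tgt = atBridge b c _ l₂ d₂ (old e P) h e' Q cnt tgt
  splitAt {u} (bridge h e w) zero = atBridge u _ 0 _ _ [] h e w refl refl
  splitAt (bridge h e w) (suc j) with splitAt w j
  ... | atBridge b c l₁ l₂ d₂ P h' e' Q cnt tgt =
        atBridge b c _ l₂ d₂ (bridge h e P) h' e' Q (cong suc cnt) tgt

  record AtTwoBridges (u v : Fin n) (d : ℕ) (j : Fin d) (c₀ c₀' : Fin n) : Set where
    constructor atTwoBridges
    field
      bᵢ cᵢ bⱼ cⱼ          : Fin n
      l₁ l₂ l₃ d₁ d₂ d₃    : ℕ
      before   : W u bᵢ l₁ d₁
      newᵢ     : H bᵢ cᵢ ≡ true
      notOldᵢ  : E bᵢ cᵢ ≡ false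
      middle   : W cᵢ bⱼ l₂ d₂
      newⱼ     : H bⱼ cⱼ ≡ true
      notOldⱼ  : E bⱼ cⱼ ≡ false
      after    : W cⱼ v l₃ d₃
      count    : d ≡ d₁ + suc (d₂ + suc d₃)
      middle≤j : d₂ ≤ toℕ j
      targetᵢ  : c₀ ≡ cᵢ
      targetⱼ  : c₀' ≡ cⱼ

  splitAtTwo : ∀ {u v l d} (w : W u v l d) (i j : Fin d) → toℕ i < toℕ j →
    AtTwoBridges u v d j (bridgeTarget w i) (bridgeTarget w j)
  splitAtTwo (old e w) i j i<j with splitAtTwo w i j i<j
  ... | atTwoBridges bᵢ cᵢ bⱼ cⱼ l₁ l₂ l₃ d₁ d₂ d₃ P hᵢ eᵢ M hⱼ eⱼ Q cnt m≤j tᵢ tⱼ =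
        atTwoBridges bᵢ cᵢ bⱼ cⱼ _ l₂ l₃ d₁ d₂ d₃ (old e P) hᵢ eᵢ M hⱼ eⱼ Q cnt m≤j tᵢ tⱼ
  splitAtTwo {u} (bridge h e w) zero (suc j) _ with splitAt w j
  ... | atBridge bⱼ cⱼ l₂ l₃ d₃ M hⱼ eⱼ Q cnt tⱼ =
        atTwoBridges u _ bⱼ cⱼ 0 l₂ l₃ 0 (toℕ j) d₃ [] h e M hⱼ eⱼ Q
          (cong suc (trans cnt (sym (+-suc (toℕ j) d₃)))) (n≤1+n _) refl tⱼ
  splitAtTwo (bridge h e w) (suc i) (suc j) (s≤s i<j) with splitAtTwo w i j i<j
  ... | atTwoBridges bᵢ cᵢ bⱼ cⱼ l₁ l₂ l₃ d₁ d₂ d₃ P hᵢ eᵢ M hⱼ eⱼ Q cnt m≤j tᵢ tⱼ =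
        atTwoBridges bᵢ cᵢ bⱼ cⱼ _ l₂ l₃ (suc d₁) d₂ d₃ (bridge h e P) hᵢ eᵢ M hⱼ eⱼ Q
          (cong suc cnt) (m≤n⇒m≤1+n m≤j) tᵢ tⱼ

  nodeAt : ∀ {u v l d} → W u v l d → Fin (suc l) → Fin n
  nodeAt {u} w          zero    = u
  nodeAt (old e w)      (suc i) = nodeAt w i
  nodeAt (bridge h e w) (suc i) = nodeAt w i

  prefix : ∀ {u v l d} (w : W u v l d) (i : Fin (suc l)) →
    Σ ℕ λ d' → d' ≤ d × W u (nodeAt w i) (toℕ i) d'
  prefix w zero = 0 , z≤n , []
  prefix (old e w) (suc i) with prefix w i
  ... | d' , d'≤d , p = d' , d'≤d , old e p
  prefix (bridge h e w) (suc i) with prefix w i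
  ... | d' , d'≤d , p = suc d' , s≤s d'≤d , bridge h e p

  ClosedWithin : ℕ → ℕ → Set
  ClosedWithin L d = Σ (Fin n) λ z → Σ ℕ λ l → suc l ≤ L × Σ ℕ λ d' → d' ≤ d × W z z (suc l) d'

  repeatedNode : ∀ {u v l d} (w : W u v l d) (i j : Fin (suc l)) → toℕ i < toℕ j →
    nodeAt w i ≡ nodeAt w j → ClosedWithin (toℕ j) d
  repeatedNode {u} (old {w = c} e w) zero (suc j) _ same with prefix w j
  ... | d' , d'≤d , p = u , toℕ j , ≤-refl , d' , d'≤d , old e (subst (λ z → W c z _ _) (sym same) p)
  repeatedNode {u} (bridge {w = c} h e w) zero (suc j) _ same with prefix w j
  ... | d' , d'≤d , p = u , toℕ j , ≤-refl , suc d' , s≤s d'≤d , bridge h e (subst (λ z → W c z _ _) (sym same) p)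
  repeatedNode (old e w) (suc i) (suc j) (s≤s i<j) same with repeatedNode w i j i<j same
  ... | z , l , l≤j , d' , d'≤d , c = z , l , m≤n⇒m≤1+n l≤j , d' , d'≤d , c
  repeatedNode (bridge h e w) (suc i) (suc j) (s≤s i<j) same with repeatedNode w i j i<j same
  ... | z , l , l≤j , d' , d'≤d , c = z , l , m≤n⇒m≤1+n l≤j , d' , m≤n⇒m≤1+n d'≤d , c

  shortenClosed : ∀ {u l d} → W u u (suc l) d → ClosedWithin n d
  shortenClosed {u} {l} {d} w with suc l ≤? n
  ... | yes short = u , l , short , d , ≤-refl , w
  ... | no long with pigeonhole-early (m≤n⇒m≤1+n (≰⇒> long)) (nodeAt w)
  ...   | i , j , i<j , j≤n , same with repeatedNode w i j i<j same
  ...     | z , l' , l'≤j , c = z , l' , ≤-trans l'≤j j≤n , c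

  walk? : ∀ L b u v → Dec (Σ ℕ λ d → d ≤ b × W u v L d)
  walk? zero b u v with u ≟ v
  ... | yes refl = yes (0 , z≤n , [])
  ... | no u≢v   = no λ { (_ , _ , []) → u≢v refl }
  walk? (suc L) b u v =
    map′ fromStep toStep (any? λ w → oldStep? w ⊎-dec bridgeStep? b w)
    where
    OldStep BridgeStep : ℕ → Fin n → Set
    OldStep b w    = E u w ≡ true × Σ ℕ λ d → d ≤ b × W w v L d
    BridgeStep b w = H u w ≡ true × E u w ≡ false × Σ ℕ λ d → suc d ≤ b × W w v L d

    oldStep? : ∀ w → Dec (OldStep b w)
    oldStep? w = (E u w Bool.≟ true) ×-dec walk? L b w v

    bridgeStep? : ∀ b w → Dec (BridgeStep b w)
    bridgeStep? zero    w = no λ { (_ , _ , _ , () , _) }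
    bridgeStep? (suc b) w =
      (H u w Bool.≟ true) ×-dec ((E u w Bool.≟ false) ×-dec
        map′ (λ { (d , d≤b , p) → d , s≤s d≤b , p }) (λ { (d , s≤s d≤b , p) → d , d≤b , p })
             (walk? L b w v))

    fromStep : ∃ (λ w → OldStep b w ⊎ BridgeStep b w) → Σ ℕ λ d → d ≤ b × W u v (suc L) d
    fromStep (w , inj₁ (e , d , d≤b , p))     = d , d≤b , old e p
    fromStep (w , inj₂ (h , e , d , d<b , p)) = suc d , d<b , bridge h e p

    toStep : (Σ ℕ λ d → d ≤ b × W u v (suc L) d) → ∃ λ w → OldStep b w ⊎ BridgeStep b w
    toStep (d , d≤b , old e p)          = _ , inj₁ (e , d , d≤b , p)
    toStep (suc d , d<b , bridge h e p) = _ , inj₂ (h , e , d , d<b , p)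

  cycle? : ∀ b → Dec (HasCycleWithin b E H)
  cycle? b = map′ fromShort toShort (any? λ u → any? λ t → walk? (suc (toℕ t)) b u u)
    where
    Short : Set
    Short = Σ (Fin n) λ u → Σ (Fin n) λ t → Σ ℕ λ d → d ≤ b × W u u (suc (toℕ t)) d

    fromShort : Short → HasCycleWithin b E H
    fromShort (u , t , d , d≤b , c) = u , toℕ t , d , d≤b , c

    toShort : HasCycleWithin b E H → Short
    toShort (u , l , d , d≤b , c) with shortenClosed c
    ... | z , l' , l'<n , d' , d'≤d , c' =
          z , fromℕ< l'<n , d' , ≤-trans d'≤d d≤b ,
          subst (λ r → W z z (suc r) d') (sym (toℕ-fromℕ< l'<n)) c'

-- Bridge count d₁ + suc (d₂ + suc d₃) of a walk cut at two bridges: replacing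
-- both bridges and the middle by at most one bridge strictly decreases it.
skip : ∀ {d₁ d₂ d₃ e} → e ≤ suc d₃ → d₁ + e < d₁ + suc (d₂ + suc d₃)
skip {d₁} {d₂} {d₃} e≤ = +-monoʳ-< d₁ (s≤s (≤-trans e≤ (m≤n+m (suc d₃) d₂)))

module BridgeReduction (ρ : InsertionQuery) where

  K : ℕ
  K = suc (arity ρ)

  -- Number of atomic types of a node relative to the k parameters.
  typeCount : ℕ
  typeCount = (2 ^ K) ^ K * (2 ^ K) ^ K

  bound : ℕ
  bound = suc (suc typeCount)

  module _ {n} (G : Graph n) (a : Fin (arity ρ) → Fin n) where
    H : Graph n
    H = apply ρ a G

    open Walks G H

    type : Fin n → Fin typeCount
    type c = combine (table G (c ∷ᵛ a)) (table _≡ᵇ_ (c ∷ᵛ a))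

    Unrelated : Fin n → Fin n → Set
    Unrelated b c = G b c ≡ false × G c b ≡ false × b ≢ c

    sameType : ∀ {c c'} → type c ≡ type c' →
      (∀ i j → G ((c ∷ᵛ a) i) ((c ∷ᵛ a) j) ≡ G ((c' ∷ᵛ a) i) ((c' ∷ᵛ a) j)) ×
      (∀ i j → ((c ∷ᵛ a) i ≡ᵇ (c ∷ᵛ a) j) ≡ ((c' ∷ᵛ a) i ≡ᵇ (c' ∷ᵛ a) j))
    sameType {c} {c'} same
      with combine-injective (table G (c ∷ᵛ a)) (table _≡ᵇ_ (c ∷ᵛ a))
                             (table G (c' ∷ᵛ a)) (table _≡ᵇ_ (c' ∷ᵛ a)) same
    ... | sameEdges , sameEqualities =
          table-injective G sameEdges , table-injective _≡ᵇ_ sameEqualities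

    transfer : ∀ {b c c'} → type c ≡ type c' → Unrelated b c → Unrelated b c' → H b c ≡ H b c'
    transfer same (bc , cb , b≢c) (bc' , c'b , b≢c') with sameType same
    ... | edges , equalities =
      cong₂ _∨_ (trans bc (sym bc'))
        (⟦⟧-atomic (φ ρ) G
          (assign-respects G edges (trans bc (sym bc')) (trans cb (sym c'b)))
          (assign-respects _≡ᵇ_ equalities
            (trans (≡ᵇ-false b≢c) (sym (≡ᵇ-false b≢c')))
            (trans (≡ᵇ-false (b≢c ∘ sym)) (sym (≡ᵇ-false (b≢c' ∘ sym))))))

    Cycle : Set
    Cycle = HasCycleWithin bound G H

    Fewer : Fin n → Fin n → ℕ → Set
    Fewer u v d = Σ ℕ λ l → Σ ℕ λ d' → d' < d × W u v l d'

    shortcut : ∀ {u v d j c c'} → AtTwoBridges u v d j c c' →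
      type c ≡ type c' → toℕ j ≤ typeCount → Cycle ⊎ Fewer u v d
    shortcut (atTwoBridges bᵢ cᵢ bⱼ cⱼ l₁ l₂ l₃ d₁ d₂ d₃ P hᵢ eᵢ M hⱼ eⱼ Q refl d₂≤j refl refl) same j≤N
      with bᵢ ≟ cᵢ | G cᵢ bᵢ in cᵢbᵢ
    ... | yes refl | _    = inj₁ (bᵢ , 0 , 1 , s≤s z≤n , bridge hᵢ eᵢ [])
    ... | no _     | true = inj₁ (bᵢ , 1 , 1 , s≤s z≤n , bridge hᵢ eᵢ (old cᵢbᵢ []))
    ... | no bᵢ≢cᵢ | false with bᵢ ≟ cⱼ | G bᵢ cⱼ in bᵢcⱼ | G cⱼ bᵢ in cⱼbᵢ
    ...   | yes refl | _     | _     = inj₂ (_ , _ , skip (n≤1+n d₃) , P ++ʷ Q)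
    ...   | no _     | true  | _     = inj₂ (_ , _ , skip (n≤1+n d₃) , P ++ʷ old bᵢcⱼ Q)
    ...   | no _     | false | true  =
            inj₁ (bᵢ , _ , _ , s≤s (≤-trans (≤-reflexive (+-comm d₂ 1)) (s≤s (≤-trans d₂≤j j≤N))) ,
                  bridge hᵢ eᵢ (M ++ʷ bridge hⱼ eⱼ (old cⱼbᵢ [])))
    ...   | no bᵢ≢cⱼ | false | false = inj₂ (_ , _ , skip ≤-refl , P ++ʷ bridge newᵢⱼ bᵢcⱼ Q)
      where
      newᵢⱼ : H bᵢ cⱼ ≡ true
      newᵢⱼ = trans (sym (transfer same (eᵢ , cᵢbᵢ , bᵢ≢cᵢ) (bᵢcⱼ , cⱼbᵢ , bᵢ≢cⱼ))) hᵢ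

    reduce : ∀ {u v l d} → Acc _<_ d → W u v l d → Cycle ⊎ BdWithin bound G H u v
    reduce {d = d} (acc smaller) w with d ≤? bound
    ... | yes d≤m = inj₂ (_ , d , d≤m , w)
    ... | no d≰m with pigeonhole-early {t = typeCount} (≤-trans (m≤n+m _ 2) (≰⇒> d≰m)) (type ∘ bridgeTarget w)
    ...   | i , j , i<j , j≤N , same with shortcut (splitAtTwo w i j i<j) same j≤N
    ...     | inj₁ cycle               = inj₁ cycle
    ...     | inj₂ (_ , _ , d'<d , w') = reduce (smaller d'<d) w'

    -- Deciding the cycle alternative makes the dichotomy uniform in u and v.
    dichotomy : Cycle ⊎ (∀ u v → Reachable G H u v → BdWithin bound G H u v)
    dichotomy with cycle? bound
    ... | yes cycle = inj₁ cycle
    ... | no noCycle = inj₂ λ u v → λ { (_ , d , w) → bounded (reduce (<-wellFounded d) w) }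
      where
      bounded : ∀ {u v} → Cycle ⊎ BdWithin bound G H u v → BdWithin bound G H u v
      bounded (inj₁ cycle) = ⊥-elim (noCycle cycle)
      bounded (inj₂ bd)    = bd

lemma6 : (ρ : InsertionQuery) → Σ ℕ λ m →
    ∀ (n : ℕ) (G : Graph n) → Acyclic G → (a : Fin (arity ρ) → Fin n) →
    HasCycleWithin m G (apply ρ a G)
    ⊎ (∀ (u v : Fin n) → Reachable G (apply ρ a G) u v →
    BdWithin m G (apply ρ a G) u v)
lemma6 ρ = bound , λ n G _ a → dichotomy G a
  where open BridgeReduction ρ
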